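{- Let $n\ge1$, $\Phi$ the root system of type $A_n$, and let $\beta_1,\dots,\beta_{n+1}\in\Phi^+$ be mutually distinct positive roots. For every permutation $\sigma$ of $\{1,\dots,n+1\}$, $$\operatorname{sign}(\beta_1,\dots,\beta_{n+1})=\operatorname{sign}(\beta_{\sigma(1)},\dots,\beta_{\sigma(n+1)}).$$
   Context: Simple roots $\alpha_i=\epsilon_i-\epsilon_{i+1}$ ($1\le i\le n$) in $\mathbb{R}^{n+1}$; positive roots $\epsilon_i-\epsilon_j=\sum_{k=i}^{j-1}\alpha_k$ ($i<j$), each identified with its coefficient vector in $\mathbb{Z}^n$. For $n$ positive roots, $\det$ is the determinant of the $n\times n$ matrix of their coefficient vectors in the given order. For a tuple $S=(\beta_1,\dots,\beta_{n+1})$, let $d_k=(-1)^k\det(\beta_1,\dots,\widehat{\beta_k},\dots,\beta_{n+1})$ (hat = omission); $\operatorname{sign}(S)$ is the unordered pair $\{a,b\}$ with $a=\#\{k:d_k=1\}$ and $b=\#\{k:d_k=-1\}$. -}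

module Defs where

open import Data.Nat as ℕ using (ℕ; zero; suc)
open import Data.Fin using (Fin; zero; suc; toℕ; punchIn; _<_; _≤_)
open import Data.Fin.Properties using (_≤?_; _<?_)
open import Data.Integer as ℤ using (ℤ; +_; -_; _*_; _+_)
open import Data.Product using (_×_; _,_)
open import Data.Sum using (_⊎_)
open import Relation.Nullary.Decidable using (Dec; yes; no; does)
open import Relation.Binary.PropositionalEquality using (_≡_)
open import Data.Bool using (if_then_else_)

-- Positive root ε_i - ε_j (0-based indices i < j in {0,…,n}) of A_n.
record PosRoot (n : ℕ) : Set where
  constructor root
  field
    i : Fin (suc n)
    j : Fin (suc n)
    i<j : i < j
open PosRoot public

-- Coefficient of α_k (0-based k, α_k = ε_k - ε_{k+1}) in ε_i - ε_j:
-- 1 if i ≤ k < j, i.e. i ≤ k and k+1 ≤ j, else 0.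
coeff : ∀ {n} → PosRoot n → Fin n → ℤ
coeff {n} β k with i β ≤? Data.Fin.inject₁ k | Data.Fin.suc k ≤? j β
... | yes _ | yes _ = + 1
... | _     | _     = + 0

∑ : ∀ {m} → (Fin m → ℤ) → ℤ
∑ {zero}  f = + 0
∑ {suc m} f = f zero + ∑ (λ x → f (suc x))

sgn : ℕ → ℤ
sgn zero    = + 1
sgn (suc k) = - sgn k

det : ∀ {m} → (Fin m → Fin m → ℤ) → ℤ
det {zero}  M = + 1
det {suc m} M = ∑ (λ c → sgn (toℕ c) * (M zero c * det (λ r s → M (suc r) (punchIn c s))))

detRoots : ∀ {n} → (Fin n → PosRoot n) → ℤ
detRoots γ = det (λ r s → coeff (γ r) s)

-- d_k = (-1)^k det(β_1,…,β̂_k,…,β_{n+1}) with k 1-based; for 0-based k this is (-1)^(k+1).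
d : ∀ {n} → (Fin (suc n) → PosRoot n) → Fin (suc n) → ℤ
d β k = sgn (suc (toℕ k)) * detRoots (λ r → β (punchIn k r))

count : ∀ {m} → (Fin m → ℤ) → ℤ → ℕ
count {zero}  f v = 0
count {suc m} f v = (if does (f zero ℤ.≟ v) then 1 else 0) ℕ.+ count (λ x → f (suc x)) v

posCount negCount : ∀ {n} → (Fin (suc n) → PosRoot n) → ℕ
posCount β = count (d β) (+ 1)
negCount β = count (d β) (- (+ 1))

UPairEq : ℕ → ℕ → ℕ → ℕ → Set
UPairEq a b a' b' = (a ≡ a' × b ≡ b') ⊎ (a ≡ b' × b ≡ a')

-- sign(S) = sign(S') as unordered pairs.
SameSign : ∀ {n} → (Fin (suc n) → PosRoot n) → (Fin (suc n) → PosRoot n) → Set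
SameSign β γ = UPairEq (posCount β) (negCount β) (posCount γ) (negCount γ)

Distinct : ∀ {n} → (Fin (suc n) → PosRoot n) → Set
Distinct β = ∀ k l → i (β k) ≡ i (β l) → j (β k) ≡ j (β l) → k ≡ l

{-# OPTIONS --safe #-}
-- Exchanging two adjacent roots β_p, β_{p+1} turns d_k into -d_{τ k}, where τ
-- transposes p and p+1: for k ∉ {p, p+1} the determinant left after deleting β_k
-- has two adjacent rows exchanged, while deleting β_p from the new tuple leaves
-- the matrix obtained by deleting β_{p+1} from the old one, with the opposite
-- sign factor. Hence an adjacent transposition exchanges the number of d_k equal
-- to 1 with the number equal to -1, and these transpositions generate all
-- permutations. The determinant facts are proved for columns, where the Laplace
-- expansion along the first row gives them by induction, and moved to rows by
-- det Mᵀ = det M.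
module Submission where

open import Defs
open import Data.Nat using (ℕ; zero; suc; _≤_)
import Data.Nat as ℕ
import Data.Nat.Properties as ℕP
open import Data.Fin using (Fin; zero; suc; toℕ; punchIn; inject₁; lift)
open import Data.Fin.Properties using (toℕ-inject₁)
open import Data.Fin.Permutation using (Permutation′; _⟨$⟩ʳ_; permutation; remove; punchIn-permute)
open import Data.Integer as ℤ using (ℤ; 1ℤ; -_; _*_; _+_)
import Data.Integer.Properties as ℤP
open import Data.Integer.Solver using (module +-*-Solver)
open import Data.List using (List; []; _∷_; _++_; map; [_])
open import Data.Product using (∃; _,_)
open import Data.Sum using (inj₁; inj₂)
open import Data.Bool using (if_then_else_)
open import Data.Vec.Functional using (transpose)
open import Function using (_∘_; _⇔_; mk⇔)
open import Relation.Nullary.Decidable using (does; does-⇔)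
open import Relation.Binary.PropositionalEquality using (_≡_; _≗_; refl; sym; trans; cong; cong₂; module ≡-Reasoning)
open ≡-Reasoning
open import Algebra.Properties.CommutativeSemigroup ℤP.*-commutativeSemigroup using (x∙yz≈y∙xz)
import Algebra.Properties.Semiring.Sum as SemiringSum
import Algebra.Properties.CommutativeMonoid.Sum as CommutativeMonoidSum

module ℤΣ = SemiringSum ℤP.+-*-semiring
module ℕΣ = CommutativeMonoidSum ℕP.+-0-commutativeMonoid

∑≡sum : ∀ {m} (f : Fin m → ℤ) → ∑ f ≡ ℤΣ.sum f
∑≡sum {zero}  f = refl
∑≡sum {suc m} f = cong (f zero +_) (∑≡sum (f ∘ suc))

∑-cong : ∀ {m} {f g : Fin m → ℤ} → f ≗ g → ∑ f ≡ ∑ g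
∑-cong {f = f} {g} f≗g = begin
  ∑ f        ≡⟨ ∑≡sum f ⟩
  ℤΣ.sum f   ≡⟨ ℤΣ.sum-cong-≗ f≗g ⟩
  ℤΣ.sum g   ≡⟨ ∑≡sum g ⟨
  ∑ g        ∎

∑-comm : ∀ {m k} (f : Fin m → Fin k → ℤ) → ∑ (λ x → ∑ (f x)) ≡ ∑ (λ y → ∑ (λ x → f x y))
∑-comm f = begin
  ∑ (λ x → ∑ (f x))                    ≡⟨ ∑≡sum (λ x → ∑ (f x)) ⟩
  ℤΣ.sum (λ x → ∑ (f x))               ≡⟨ ℤΣ.sum-cong-≗ (∑≡sum ∘ f) ⟩
  ℤΣ.sum (λ x → ℤΣ.sum (f x))          ≡⟨ ℤΣ.∑-comm f ⟩
  ℤΣ.sum (λ y → ℤΣ.sum (λ x → f x y))  ≡⟨ ℤΣ.sum-cong-≗ (λ y → ∑≡sum (λ x → f x y)) ⟨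
  ℤΣ.sum (λ y → ∑ (λ x → f x y))       ≡⟨ ∑≡sum (λ y → ∑ (λ x → f x y)) ⟨
  ∑ (λ y → ∑ (λ x → f x y))            ∎

*-distribˡ-∑ : ∀ {m} x (f : Fin m → ℤ) → x * ∑ f ≡ ∑ (λ i → x * f i)
*-distribˡ-∑ x f = begin
  x * ∑ f                     ≡⟨ cong (x *_) (∑≡sum f) ⟩
  x * ℤΣ.sum f                ≡⟨ ℤΣ.*-distribˡ-sum x f ⟩
  ℤΣ.sum (λ i → x * f i)      ≡⟨ ∑≡sum (λ i → x * f i) ⟨
  ∑ (λ i → x * f i)           ∎

∑-permute : ∀ {m} (f : Fin m → ℤ) (π : Permutation′ m) → ∑ (f ∘ (π ⟨$⟩ʳ_)) ≡ ∑ f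
∑-permute f π = begin
  ∑ (f ∘ (π ⟨$⟩ʳ_))       ≡⟨ ∑≡sum (f ∘ (π ⟨$⟩ʳ_)) ⟩
  ℤΣ.sum (f ∘ (π ⟨$⟩ʳ_))  ≡⟨ ℤΣ.sum-permute f π ⟨
  ℤΣ.sum f                ≡⟨ ∑≡sum f ⟨
  ∑ f                     ∎

∑-neg : ∀ {m} (f : Fin m → ℤ) → ∑ (λ i → - f i) ≡ - ∑ f
∑-neg {zero}  f = refl
∑-neg {suc m} f = trans (cong (- f zero +_) (∑-neg (f ∘ suc))) (sym (ℤP.neg-distrib-+ (f zero) _))

∑-scale : ∀ {m} x y (f : Fin m → ℤ) → x * (y * ∑ f) ≡ ∑ (λ i → x * (y * f i))
∑-scale x y f = trans (cong (x *_) (*-distribˡ-∑ y f)) (*-distribˡ-∑ x (λ i → y * f i))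

indicator : ∀ {m} → (Fin m → ℤ) → ℤ → Fin m → ℕ
indicator f v k = if does (f k ℤ.≟ v) then 1 else 0

count≡sum : ∀ {m} (f : Fin m → ℤ) v → count f v ≡ ℕΣ.sum (indicator f v)
count≡sum {zero}  f v = refl
count≡sum {suc m} f v = cong (indicator f v zero ℕ.+_) (count≡sum (f ∘ suc) v)

count-permute : ∀ {m} (f : Fin m → ℤ) (π : Permutation′ m) v → count (f ∘ (π ⟨$⟩ʳ_)) v ≡ count f v
count-permute f π v = begin
  count (f ∘ (π ⟨$⟩ʳ_)) v                   ≡⟨ count≡sum (f ∘ (π ⟨$⟩ʳ_)) v ⟩
  ℕΣ.sum (indicator f v ∘ (π ⟨$⟩ʳ_))        ≡⟨ ℕΣ.sum-permute (indicator f v) π ⟨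
  ℕΣ.sum (indicator f v)                    ≡⟨ count≡sum f v ⟨
  count f v                                 ∎

count-cong-⇔ : ∀ {m} {f g : Fin m → ℤ} {v w} →
               (∀ k → (f k ≡ v) ⇔ (g k ≡ w)) → count f v ≡ count g w
count-cong-⇔ {zero}  eq = refl
count-cong-⇔ {suc m} {f} {g} {v} {w} eq =
  cong₂ (λ b n → (if b then 1 else 0) ℕ.+ n)
        (does-⇔ (eq zero) (f zero ℤ.≟ v) (g zero ℤ.≟ w))
        (count-cong-⇔ (eq ∘ suc))

count-cong : ∀ {m} {f g : Fin m → ℤ} {v} → f ≗ g → count f v ≡ count g v
count-cong f≗g = count-cong-⇔ (λ k → mk⇔ (trans (sym (f≗g k))) (trans (f≗g k)))

count-neg : ∀ {m} (f : Fin m → ℤ) v → count (λ k → - f k) v ≡ count f (- v)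
count-neg f v = count-cong-⇔ λ k → mk⇔
  (λ -fk≡v → trans (sym (ℤP.neg-involutive (f k))) (cong -_ -fk≡v))
  (λ fk≡-v → trans (cong -_ fk≡-v) (ℤP.neg-involutive v))

det-cong : ∀ {m} {M N : Fin m → Fin m → ℤ} → (∀ r s → M r s ≡ N r s) → det M ≡ det N
det-cong {zero}  M≡N = refl
det-cong {suc m} M≡N = ∑-cong λ c →
  cong₂ (λ x y → sgn (toℕ c) * (x * y)) (M≡N zero c) (det-cong (λ r s → M≡N (suc r) (punchIn c s)))

cofactor : ∀ {m} → (Fin m → Fin (suc m) → ℤ) → Fin (suc m) → ℤ
cofactor A c = sgn (toℕ c) * det (λ r s → A r (punchIn c s))

det-expand-row : ∀ {m} (M : Fin (suc m) → Fin (suc m) → ℤ) →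
                 det M ≡ ∑ (λ c → M zero c * cofactor (M ∘ suc) c)
det-expand-row M = ∑-cong λ c →
  x∙yz≈y∙xz (sgn (toℕ c)) (M zero c) (det (λ r s → M (suc r) (punchIn c s)))

det-expand-column : ∀ {m} (M : Fin (suc m) → Fin (suc m) → ℤ) →
  det M ≡ ∑ (λ r → sgn (toℕ r) * (M r zero * det (λ s t → M (punchIn r s) (suc t))))
det-expand-column {zero}  M = refl
det-expand-column {suc m} M = cong (sgn 0 * (M zero zero * det (λ r s → M (suc r) (suc s))) +_) (begin
  ∑ (λ c → - sgn (toℕ c) * (a c * det (minor c)))
    ≡⟨ ∑-cong (λ c → cong (λ x → - sgn (toℕ c) * (a c * x)) (det-expand-column (minor c))) ⟩
  ∑ (λ c → - sgn (toℕ c) * (a c * ∑ (λ r → sgn (toℕ r) * (b r * Y c r))))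
    ≡⟨ ∑-cong (λ c → ∑-scale (- sgn (toℕ c)) (a c) (λ r → sgn (toℕ r) * (b r * Y c r))) ⟩
  ∑ (λ c → ∑ (λ r → - sgn (toℕ c) * (a c * (sgn (toℕ r) * (b r * Y c r)))))
    ≡⟨ ∑-comm (λ c r → - sgn (toℕ c) * (a c * (sgn (toℕ r) * (b r * Y c r)))) ⟩
  ∑ (λ r → ∑ (λ c → - sgn (toℕ c) * (a c * (sgn (toℕ r) * (b r * Y c r)))))
    ≡⟨ ∑-cong (λ r → ∑-cong (λ c → exchange (sgn (toℕ c)) (a c) (sgn (toℕ r)) (b r) (Y c r))) ⟩
  ∑ (λ r → ∑ (λ c → - sgn (toℕ r) * (b r * (sgn (toℕ c) * (a c * Y c r)))))
    ≡⟨ ∑-cong (λ r → ∑-scale (- sgn (toℕ r)) (b r) (λ c → sgn (toℕ c) * (a c * Y c r))) ⟨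
  ∑ (λ r → - sgn (toℕ r) * (b r * ∑ (λ c → sgn (toℕ c) * (a c * Y c r)))) ∎)
  where
    open +-*-Solver
    a : Fin (suc m) → ℤ
    a c = M zero (suc c)
    b : Fin (suc m) → ℤ
    b r = M (suc r) zero
    minor : Fin (suc m) → Fin (suc m) → Fin (suc m) → ℤ
    minor c r s = M (suc r) (punchIn (suc c) s)
    Y : Fin (suc m) → Fin (suc m) → ℤ
    Y c r = det (λ s t → M (suc (punchIn r s)) (suc (punchIn c t)))
    exchange : ∀ x y z u w → - x * (y * (z * (u * w))) ≡ - z * (u * (x * (y * w)))
    exchange = solve 5 (λ x y z u w → (:- x) :* (y :* (z :* (u :* w))) := (:- z) :* (u :* (x :* (y :* w)))) refl

det-transpose : ∀ {m} (M : Fin m → Fin m → ℤ) → det (transpose M) ≡ det M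
det-transpose {zero}  M = refl
det-transpose {suc m} M = begin
  ∑ (λ c → sgn (toℕ c) * (M c zero * det (transpose (λ s t → M (punchIn c s) (suc t)))))
    ≡⟨ ∑-cong (λ c → cong (λ x → sgn (toℕ c) * (M c zero * x))
                          (det-transpose (λ s t → M (punchIn c s) (suc t)))) ⟩
  ∑ (λ c → sgn (toℕ c) * (M c zero * det (λ s t → M (punchIn c s) (suc t))))
    ≡⟨ det-expand-column M ⟨
  det M ∎

swapAdjacent : ∀ {m} → Fin m → Fin (suc m) → Fin (suc m)
swapAdjacent zero    zero          = suc zero
swapAdjacent zero    (suc zero)    = zero
swapAdjacent zero    (suc (suc k)) = suc (suc k)
swapAdjacent (suc p) zero          = zero
swapAdjacent (suc p) (suc k)       = suc (swapAdjacent p k)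

swapAdjacent-involutive : ∀ {m} (p : Fin m) k → swapAdjacent p (swapAdjacent p k) ≡ k
swapAdjacent-involutive zero    zero          = refl
swapAdjacent-involutive zero    (suc zero)    = refl
swapAdjacent-involutive zero    (suc (suc k)) = refl
swapAdjacent-involutive (suc p) zero          = refl
swapAdjacent-involutive (suc p) (suc k)       = cong suc (swapAdjacent-involutive p k)

swapAdjacentₚ : ∀ {m} → Fin m → Permutation′ (suc m)
swapAdjacentₚ p =
  permutation (swapAdjacent p) (swapAdjacent p) (swapAdjacent-involutive p) (swapAdjacent-involutive p)

swapAdjacent-inject₁ : ∀ {m} (p : Fin m) → swapAdjacent p (inject₁ p) ≡ suc p
swapAdjacent-inject₁ zero    = refl
swapAdjacent-inject₁ (suc p) = cong suc (swapAdjacent-inject₁ p)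

swapAdjacent-suc : ∀ {m} (p : Fin m) → swapAdjacent p (suc p) ≡ inject₁ p
swapAdjacent-suc zero    = refl
swapAdjacent-suc (suc p) = cong suc (swapAdjacent-suc p)

swapAdjacent-punchIn-inject₁ : ∀ {m} (p : Fin m) → swapAdjacent p ∘ punchIn (inject₁ p) ≗ punchIn (suc p)
swapAdjacent-punchIn-inject₁ zero    zero    = refl
swapAdjacent-punchIn-inject₁ zero    (suc s) = refl
swapAdjacent-punchIn-inject₁ (suc p) zero    = refl
swapAdjacent-punchIn-inject₁ (suc p) (suc s) = cong suc (swapAdjacent-punchIn-inject₁ p s)

swapAdjacent-punchIn-suc : ∀ {m} (p : Fin m) → swapAdjacent p ∘ punchIn (suc p) ≗ punchIn (inject₁ p)
swapAdjacent-punchIn-suc zero    zero    = refl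
swapAdjacent-punchIn-suc zero    (suc s) = refl
swapAdjacent-punchIn-suc (suc p) zero    = refl
swapAdjacent-punchIn-suc (suc p) (suc s) = cong suc (swapAdjacent-punchIn-suc p s)

data AdjacentView {n} (p : Fin (suc n)) : Fin (suc (suc n)) → Set where
  at-inject₁ : AdjacentView p (inject₁ p)
  at-suc     : AdjacentView p (suc p)
  away       : ∀ {k} (q : Fin n) → swapAdjacent p k ≡ k →
               swapAdjacent p ∘ punchIn k ≗ punchIn k ∘ swapAdjacent q → AdjacentView p k

adjacentView : ∀ {n} (p : Fin (suc n)) k → AdjacentView p k
adjacentView zero zero = at-inject₁
adjacentView zero (suc zero) = at-suc
adjacentView {suc n} zero (suc (suc k)) = away zero refl commute
  where
    commute : swapAdjacent zero ∘ punchIn (suc (suc k)) ≗ punchIn (suc (suc k)) ∘ swapAdjacent zero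
    commute zero          = refl
    commute (suc zero)    = refl
    commute (suc (suc s)) = refl
adjacentView {suc n} (suc p) zero = away p refl (λ s → refl)
adjacentView {suc n} (suc p) (suc k) with adjacentView p k
... | at-inject₁            = at-inject₁
... | at-suc                = at-suc
... | away q fixed commute  = away (suc q) (cong suc fixed) λ
  { zero    → refl
  ; (suc s) → cong suc (commute s)
  }

det-swapAdjacent-columns : ∀ {m} (p : Fin m) (M : Fin (suc m) → Fin (suc m) → ℤ) →
  det (λ r s → M r (swapAdjacent p s)) ≡ - det M
cofactor-swapAdjacent : ∀ {m} (p : Fin m) (A : Fin m → Fin (suc m) → ℤ) c →
  cofactor (λ r s → A r (swapAdjacent p s)) c ≡ - cofactor A (swapAdjacent p c)

det-swapAdjacent-columns p M = begin
  det (λ r s → M r (swapAdjacent p s))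
    ≡⟨ det-expand-row (λ r s → M r (swapAdjacent p s)) ⟩
  ∑ (λ c → M zero (swapAdjacent p c) * cofactor (λ r s → M (suc r) (swapAdjacent p s)) c)
    ≡⟨ ∑-cong (λ c → cong (M zero (swapAdjacent p c) *_) (cofactor-swapAdjacent p (M ∘ suc) c)) ⟩
  ∑ (λ c → M zero (swapAdjacent p c) * - C (swapAdjacent p c))
    ≡⟨ ∑-cong (λ c → ℤP.neg-distribʳ-* (M zero (swapAdjacent p c)) (C (swapAdjacent p c))) ⟨
  ∑ (λ c → - expansionTerm (swapAdjacent p c))
    ≡⟨ ∑-neg (expansionTerm ∘ swapAdjacent p) ⟩
  - ∑ (expansionTerm ∘ swapAdjacent p)
    ≡⟨ cong -_ (∑-permute expansionTerm (swapAdjacentₚ p)) ⟩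
  - ∑ expansionTerm
    ≡⟨ cong -_ (det-expand-row M) ⟨
  - det M ∎
  where
    C : Fin _ → ℤ
    C = cofactor (M ∘ suc)
    expansionTerm : Fin _ → ℤ
    expansionTerm c = M zero c * C c

cofactor-swapAdjacent {suc n} p A c with adjacentView p c
... | at-inject₁ = begin
  sgn (toℕ (inject₁ p)) * det (λ r s → A r (swapAdjacent p (punchIn (inject₁ p) s)))
    ≡⟨ cong₂ (λ i x → sgn i * x) (toℕ-inject₁ p)
             (det-cong (λ r s → cong (A r) (swapAdjacent-punchIn-inject₁ p s))) ⟩
  sgn (toℕ p) * det (λ r s → A r (punchIn (suc p) s))
    ≡⟨ neg-neg-distribˡ (sgn (toℕ p)) _ ⟩
  - cofactor A (suc p)
    ≡⟨ cong (-_ ∘ cofactor A) (swapAdjacent-inject₁ p) ⟨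
  - cofactor A (swapAdjacent p (inject₁ p)) ∎
  where
    neg-neg-distribˡ : ∀ x y → x * y ≡ - (- x * y)
    neg-neg-distribˡ x y = trans (sym (ℤP.neg-involutive (x * y))) (cong -_ (ℤP.neg-distribˡ-* x y))
... | at-suc = begin
  - sgn (toℕ p) * det (λ r s → A r (swapAdjacent p (punchIn (suc p) s)))
    ≡⟨ cong₂ (λ i x → - sgn i * x) (sym (toℕ-inject₁ p))
             (det-cong (λ r s → cong (A r) (swapAdjacent-punchIn-suc p s))) ⟩
  - sgn (toℕ (inject₁ p)) * det (λ r s → A r (punchIn (inject₁ p) s))
    ≡⟨ ℤP.neg-distribˡ-* (sgn (toℕ (inject₁ p))) _ ⟨
  - cofactor A (inject₁ p)
    ≡⟨ cong (-_ ∘ cofactor A) (swapAdjacent-suc p) ⟨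
  - cofactor A (swapAdjacent p (suc p)) ∎
... | away q fixed commute = begin
  sgn (toℕ c) * det (λ r s → A r (swapAdjacent p (punchIn c s)))
    ≡⟨ cong (sgn (toℕ c) *_) (det-cong (λ r s → cong (A r) (commute s))) ⟩
  sgn (toℕ c) * det (λ r s → A r (punchIn c (swapAdjacent q s)))
    ≡⟨ cong (sgn (toℕ c) *_) (det-swapAdjacent-columns q (λ r s → A r (punchIn c s))) ⟩
  sgn (toℕ c) * - det (λ r s → A r (punchIn c s))
    ≡⟨ ℤP.neg-distribʳ-* (sgn (toℕ c)) _ ⟨
  - cofactor A c
    ≡⟨ cong (-_ ∘ cofactor A) fixed ⟨
  - cofactor A (swapAdjacent p c) ∎

rootColumns : ∀ {n} → (Fin (suc n) → PosRoot n) → Fin n → Fin (suc n) → ℤ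
rootColumns β s r = coeff (β r) s

d≡-cofactor : ∀ {n} (β : Fin (suc n) → PosRoot n) k → d β k ≡ - cofactor (rootColumns β) k
d≡-cofactor β k = begin
  - sgn (toℕ k) * detRoots (β ∘ punchIn k)
    ≡⟨ cong (- sgn (toℕ k) *_) (det-transpose (λ r s → coeff (β (punchIn k r)) s)) ⟨
  - sgn (toℕ k) * det (λ s r → rootColumns β s (punchIn k r))
    ≡⟨ ℤP.neg-distribˡ-* (sgn (toℕ k)) _ ⟨
  - cofactor (rootColumns β) k ∎

d-swapAdjacent : ∀ {n} (β : Fin (suc n) → PosRoot n) p k →
                 d (β ∘ swapAdjacent p) k ≡ - d β (swapAdjacent p k)
d-swapAdjacent β p k = begin
  d (β ∘ swapAdjacent p) k
    ≡⟨ d≡-cofactor (β ∘ swapAdjacent p) k ⟩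
  - cofactor (λ s r → rootColumns β s (swapAdjacent p r)) k
    ≡⟨ cong -_ (cofactor-swapAdjacent p (rootColumns β) k) ⟩
  - - cofactor (rootColumns β) (swapAdjacent p k)
    ≡⟨ cong -_ (d≡-cofactor β (swapAdjacent p k)) ⟨
  - d β (swapAdjacent p k) ∎

d-cong : ∀ {n} {β γ : Fin (suc n) → PosRoot n} → β ≗ γ → d β ≗ d γ
d-cong β≗γ k = cong (sgn (suc (toℕ k)) *_) (det-cong (λ r s → cong (λ b → coeff b s) (β≗γ (punchIn k r))))

UPairEq-trans : ∀ {a b a′ b′ a″ b″} → UPairEq a b a′ b′ → UPairEq a′ b′ a″ b″ → UPairEq a b a″ b″
UPairEq-trans (inj₁ (e₁ , e₂)) (inj₁ (e₃ , e₄)) = inj₁ (trans e₁ e₃ , trans e₂ e₄)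
UPairEq-trans (inj₁ (e₁ , e₂)) (inj₂ (e₃ , e₄)) = inj₂ (trans e₁ e₃ , trans e₂ e₄)
UPairEq-trans (inj₂ (e₁ , e₂)) (inj₁ (e₃ , e₄)) = inj₂ (trans e₁ e₄ , trans e₂ e₃)
UPairEq-trans (inj₂ (e₁ , e₂)) (inj₂ (e₃ , e₄)) = inj₁ (trans e₁ e₄ , trans e₂ e₃)

sameSign-≗ : ∀ {n} {β γ : Fin (suc n) → PosRoot n} → β ≗ γ → SameSign β γ
sameSign-≗ β≗γ = inj₁ (count-cong (d-cong β≗γ) , count-cong (d-cong β≗γ))

sameSign-swapAdjacent : ∀ {n} (β : Fin (suc n) → PosRoot n) p → SameSign β (β ∘ swapAdjacent p)
sameSign-swapAdjacent β p = inj₂ (sym (count-swapped (- 1ℤ)) , sym (count-swapped 1ℤ))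
  where
    count-swapped : ∀ v → count (d (β ∘ swapAdjacent p)) v ≡ count (d β) (- v)
    count-swapped v = begin
      count (d (β ∘ swapAdjacent p)) v               ≡⟨ count-cong (d-swapAdjacent β p) ⟩
      count (λ k → - d β (swapAdjacent p k)) v       ≡⟨ count-neg (d β ∘ swapAdjacent p) v ⟩
      count (d β ∘ swapAdjacent p) (- v)             ≡⟨ count-permute (d β) (swapAdjacentₚ p) (- v) ⟩
      count (d β) (- v)                              ∎

composeSwaps : ∀ {m} → List (Fin m) → Fin (suc m) → Fin (suc m)
composeSwaps []      = λ k → k
composeSwaps (p ∷ w) = swapAdjacent p ∘ composeSwaps w

sameSign-composeSwaps : ∀ {n} w (β : Fin (suc n) → PosRoot n) → SameSign β (β ∘ composeSwaps w)
sameSign-composeSwaps []      β = inj₁ (refl , refl)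
sameSign-composeSwaps (p ∷ w) β =
  UPairEq-trans (sameSign-swapAdjacent β p) (sameSign-composeSwaps w (β ∘ swapAdjacent p))

IsSwapProduct : ∀ {m} → (Fin (suc m) → Fin (suc m)) → Set
IsSwapProduct h = ∃ λ w → h ≗ composeSwaps w

isSwapProduct-≗ : ∀ {m} {h g : Fin (suc m) → Fin (suc m)} → h ≗ g → IsSwapProduct h → IsSwapProduct g
isSwapProduct-≗ h≗g (w , h≗w) = w , λ k → trans (sym (h≗g k)) (h≗w k)

isSwapProduct-swapAdjacent : ∀ {m} (p : Fin m) → IsSwapProduct (swapAdjacent p)
isSwapProduct-swapAdjacent p = [ p ] , λ k → refl

composeSwaps-++ : ∀ {m} (w v : List (Fin m)) → composeSwaps (w ++ v) ≗ composeSwaps w ∘ composeSwaps v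
composeSwaps-++ []      v k = refl
composeSwaps-++ (p ∷ w) v k = cong (swapAdjacent p) (composeSwaps-++ w v k)

composeSwaps-map-suc : ∀ {m} (w : List (Fin m)) → composeSwaps (map suc w) ≗ lift 1 (composeSwaps w)
composeSwaps-map-suc []      zero    = refl
composeSwaps-map-suc []      (suc k) = refl
composeSwaps-map-suc (p ∷ w) k       = begin
  swapAdjacent (suc p) (composeSwaps (map suc w) k)  ≡⟨ cong (swapAdjacent (suc p)) (composeSwaps-map-suc w k) ⟩
  swapAdjacent (suc p) (lift 1 (composeSwaps w) k)   ≡⟨ swapAdjacent-suc-lift k ⟩
  lift 1 (swapAdjacent p ∘ composeSwaps w) k         ∎
  where
    swapAdjacent-suc-lift : swapAdjacent (suc p) ∘ lift 1 (composeSwaps w) ≗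
                            lift 1 (swapAdjacent p ∘ composeSwaps w)
    swapAdjacent-suc-lift zero    = refl
    swapAdjacent-suc-lift (suc k) = refl

isSwapProduct-∘ : ∀ {m} {h g : Fin (suc m) → Fin (suc m)} →
                  IsSwapProduct h → IsSwapProduct g → IsSwapProduct (h ∘ g)
isSwapProduct-∘ {h = h} {g} (w , h≗w) (v , g≗v) = w ++ v , λ k → begin
  h (g k)                            ≡⟨ h≗w (g k) ⟩
  composeSwaps w (g k)               ≡⟨ cong (composeSwaps w) (g≗v k) ⟩
  composeSwaps w (composeSwaps v k)  ≡⟨ composeSwaps-++ w v k ⟨
  composeSwaps (w ++ v) k            ∎

isSwapProduct-lift : ∀ {m} {h : Fin (suc m) → Fin (suc m)} → IsSwapProduct h → IsSwapProduct (lift 1 h)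
isSwapProduct-lift (w , h≗w) = map suc w , λ
  { zero    → sym (composeSwaps-map-suc w zero)
  ; (suc k) → trans (cong suc (h≗w k)) (sym (composeSwaps-map-suc w (suc k)))
  }

moveZeroTo : ∀ {m} → Fin (suc m) → Fin (suc m) → Fin (suc m)
moveZeroTo j zero    = j
moveZeroTo j (suc s) = punchIn j s

isSwapProduct-moveZeroTo : ∀ {m} (j : Fin (suc m)) → IsSwapProduct (moveZeroTo j)
isSwapProduct-moveZeroTo zero = [] , λ { zero → refl ; (suc s) → refl }
isSwapProduct-moveZeroTo {suc m} (suc j) =
  isSwapProduct-≗ factor (isSwapProduct-∘ (isSwapProduct-lift (isSwapProduct-moveZeroTo j))
                                           (isSwapProduct-swapAdjacent zero))
  where
    factor : lift 1 (moveZeroTo j) ∘ swapAdjacent zero ≗ moveZeroTo (suc j)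
    factor zero          = refl
    factor (suc zero)    = refl
    factor (suc (suc s)) = refl

isSwapProduct-permutation : ∀ {m} (σ : Permutation′ (suc m)) → IsSwapProduct (σ ⟨$⟩ʳ_)
isSwapProduct-permutation {zero} σ = [] , identity
  where
    identity : ∀ k → σ ⟨$⟩ʳ k ≡ k
    identity zero with σ ⟨$⟩ʳ zero
    ... | zero = refl
isSwapProduct-permutation {suc m} σ =
  isSwapProduct-≗ factor (isSwapProduct-∘ (isSwapProduct-moveZeroTo (σ ⟨$⟩ʳ zero))
                                           (isSwapProduct-lift (isSwapProduct-permutation (remove zero σ))))
  where
    factor : moveZeroTo (σ ⟨$⟩ʳ zero) ∘ lift 1 (remove zero σ ⟨$⟩ʳ_) ≗ σ ⟨$⟩ʳ_
    factor zero    = refl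
    factor (suc s) = sym (punchIn-permute σ zero s)

lemma2p2 : (n : ℕ) → 1 ≤ n → (β : Fin (suc n) → PosRoot n) → Distinct β →
    (σ : Permutation′ (suc n)) → SameSign β (λ k → β (σ ⟨$⟩ʳ k))
lemma2p2 n _ β _ σ with isSwapProduct-permutation σ
... | w , σ≗w = UPairEq-trans (sameSign-composeSwaps w β) (sameSign-≗ (λ k → cong β (sym (σ≗w k))))
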